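{- Let $\ell, m \in \mathbf{N}_0$ with $m \geq 2$. For $x = (x_1,\ldots,x_m) \in \mathbf{N}_0^m$ let $\min(x) = \min(x_i : i = 1,\ldots,m)$, and let $S = \{x \in \mathbf{N}_0^m : \min(x) \geq \ell\}$. Then no linear polynomial $F(x_1,\ldots,x_m) = a_1x_1 + \cdots + a_m x_m + c$ (with real coefficients $a_1,\ldots,a_m,c$) is a storing function on $S$, i.e., there is no such $F$ with $F(S) \subseteq \mathbf{N}_0$ and $F$ one-to-one on $S$.
   Context: $\mathbf{N}_0 = \{0,1,2,\ldots\}$ and $\mathbf{N}_0^m$ is the set of lattice points of $\mathbf{Z}^m$ with all coordinates nonnegative. For $S \subseteq \mathbf{Z}^m$, a storing function on $S$ is a one-to-one function from $S$ into $\mathbf{N}_0$. -}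

module Defs where

open import Level using (Level; _⊔_) renaming (suc to lsuc)
open import Algebra.Bundles using (CommutativeRing)
open import Data.Nat as ℕ using (ℕ; zero; suc)
open import Data.Fin using (Fin)
open import Data.Product using (Σ; ∃; _×_)
open import Relation.Nullary using (¬_)
open import Relation.Unary using (Pred)
open import Data.Sum using (_⊎_)
import Data.Fin as Fin
open import Relation.Binary.PropositionalEquality using (_≡_)

-- An axiomatic model of the real numbers: a complete ordered field.
-- (agda-stdlib has no real numbers; the theorem is stated for every
-- structure satisfying the axioms of ℝ.)
record RealNumbers (c ℓ : Level) : Set (lsuc (c ⊔ ℓ)) where
  field
    commRing : CommutativeRing c ℓ
  open CommutativeRing commRing public
  field
    0≉1     : ¬ (0# ≈ 1#)
    inverse : ∀ x → ¬ (x ≈ 0#) → ∃ λ y → x * y ≈ 1#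
    _≤_       : Carrier → Carrier → Set ℓ
    ≤-resp-≈  : ∀ {x x′ y y′} → x ≈ x′ → y ≈ y′ → x ≤ y → x′ ≤ y′
    ≤-refl    : ∀ {x} → x ≤ x
    ≤-trans   : ∀ {x y z} → x ≤ y → y ≤ z → x ≤ z
    ≤-antisym : ∀ {x y} → x ≤ y → y ≤ x → x ≈ y
    ≤-total   : ∀ x y → (x ≤ y) ⊎ (y ≤ x)
    +-mono-≤  : ∀ {x y} z → x ≤ y → (x + z) ≤ (y + z)
    *-nonneg  : ∀ {x y} → 0# ≤ x → 0# ≤ y → 0# ≤ (x * y)
    complete  : (P : Pred Carrier ℓ) → (∃ λ x → P x) →
                (∃ λ b → ∀ x → P x → x ≤ b) →
                ∃ λ s → (∀ x → P x → x ≤ s) ×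
                        (∀ b → (∀ x → P x → x ≤ b) → s ≤ b)

module _ {c ℓ : Level} (R : RealNumbers c ℓ) where
  open RealNumbers R

  ι : ℕ → Carrier
  ι zero    = 0#
  ι (suc n) = 1# + ι n

  sumFin : (m : ℕ) → (Fin m → Carrier) → Carrier
  sumFin zero    f = 0#
  sumFin (suc m) f = f Fin.zero + sumFin m (λ i → f (Fin.suc i))

  linF : (m : ℕ) → (a : Fin m → Carrier) → (c₀ : Carrier) → (Fin m → ℕ) → Carrier
  linF m a c₀ x = sumFin m (λ i → a i * ι (x i)) + c₀

  -- S = { x ∈ ℕ₀^m : min(x) ≥ ℓ }  ( min(x) ≥ ℓ  iff every coordinate ≥ ℓ )
  InS : (l m : ℕ) → (Fin m → ℕ) → Set
  InS l m x = ∀ i → l ℕ.≤ x i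

  StoringLinear : (l m : ℕ) → (a : Fin m → Carrier) → (c₀ : Carrier) → Set ℓ
  StoringLinear l m a c₀ =
    (∀ x → InS l m x → ∃ λ (n : ℕ) → linF m a c₀ x ≈ ι n) ×
    (∀ x y → InS l m x → InS l m y → linF m a c₀ x ≈ linF m a c₀ y → ∀ i → x i ≡ y i)

-- Restrict F to the plane (u, v) ↦ (u + ℓ, v + ℓ, ℓ, …, ℓ) inside S, where it becomes an
-- affine map G(u, v) = X + a u + b v with natural values p = G(0,0), q = G(1,0),
-- r = G(0,1).  Then G(r, p) and G(p, q) both equal X + aX + bX + ab, so injectivity
-- forces p = q, i.e. G(0,0) = G(1,0), contradicting injectivity once more.
module Submission where

open import Defs
open import Level using (Level)
open import Data.Nat as ℕ using (ℕ; _≤_; zero; suc; z≤n; s≤s)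
open import Data.Nat.Properties using (m≤n+m; ≤-refl; +-cancelʳ-≡; 0≢1+n)
open import Data.Fin using (Fin) renaming (zero to fzero; suc to fsuc)
open import Data.Product using (∃; _,_; proj₁; proj₂)
open import Data.Maybe using (nothing)
open import Relation.Binary.PropositionalEquality using (_≡_; cong)
open import Relation.Nullary using (¬_)
open import Algebra.Solver.Ring.AlmostCommutativeRing
  using (AlmostCommutativeRing; fromCommutativeRing; -raw-almostCommutative⟶)
import Algebra.Solver.Ring as RingSolver
import Relation.Binary.Reasoning.Setoid as SetoidReasoning

-- u + l rather than l + u, so that plane l k 0 0 reduces to the constant point l.
plane : (l k : ℕ) → ℕ → ℕ → Fin (suc (suc k)) → ℕ
plane l k u v fzero           = u ℕ.+ l
plane l k u v (fsuc fzero)    = v ℕ.+ l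
plane l k u v (fsuc (fsuc _)) = l

plane-InS : ∀ {c ℓ} (R : RealNumbers c ℓ) (l k u v : ℕ) → InS R l (suc (suc k)) (plane l k u v)
plane-InS R l k u v fzero           = m≤n+m l u
plane-InS R l k u v (fsuc fzero)    = m≤n+m l v
plane-InS R l k u v (fsuc (fsuc _)) = ≤-refl

plane-injectiveˡ : ∀ {l k u v u′ v′} → (∀ i → plane l k u v i ≡ plane l k u′ v′ i) → u ≡ u′
plane-injectiveˡ {l} {u = u} {u′ = u′} eq = +-cancelʳ-≡ l u u′ (eq fzero)

plane-injectiveʳ : ∀ {l k u v u′ v′} → (∀ i → plane l k u v i ≡ plane l k u′ v′ i) → v ≡ v′
plane-injectiveʳ {l} {v = v} {v′ = v′} eq = +-cancelʳ-≡ l v v′ (eq (fsuc fzero))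

module _ {c ℓ : Level} (R : RealNumbers c ℓ) where
  open RealNumbers R
  open SetoidReasoning setoid
  private
    almostRing = fromCommutativeRing commRing
  open RingSolver (AlmostCommutativeRing.rawRing almostRing) almostRing
    (-raw-almostCommutative⟶ almostRing) (λ _ _ → nothing)

  ι-+ : ∀ m n → ι R (m ℕ.+ n) ≈ ι R m + ι R n
  ι-+ zero    n = sym (+-identityˡ (ι R n))
  ι-+ (suc m) n = trans (+-congˡ (ι-+ m n)) (sym (+-assoc 1# (ι R m) (ι R n)))

  affine : Carrier → Carrier → Carrier → ℕ → ℕ → Carrier
  affine X a b u v = X + (a * ι R u + b * ι R v)

  affine-collision : ∀ {X a b p q r} →
                     ι R p ≈ affine X a b 0 0 → ι R q ≈ affine X a b 1 0 → ι R r ≈ affine X a b 0 1 →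
                     affine X a b r p ≈ affine X a b p q
  affine-collision {X} {a} {b} {p} {q} {r} p≈ q≈ r≈ = begin
    affine X a b r p                                  ≈⟨ +-congˡ (+-cong (*-congˡ r≈) (*-congˡ p≈)) ⟩
    X + (a * affine X a b 0 1 + b * affine X a b 0 0) ≈⟨ identity ⟩
    X + (a * affine X a b 0 0 + b * affine X a b 1 0) ≈˘⟨ +-congˡ (+-cong (*-congˡ p≈) (*-congˡ q≈)) ⟩
    affine X a b p q                                  ∎
    where
    identity : X + (a * affine X a b 0 1 + b * affine X a b 0 0) ≈
               X + (a * affine X a b 0 0 + b * affine X a b 1 0)
    -- ι 0 and ι 1 stay variables: the solver, lacking decidable equality, cannot normalise constants.
    identity = solve 5 (λ X a b ι₀ ι₁ →
        X :+ (a :* (X :+ (a :* ι₀ :+ b :* ι₁)) :+ b :* (X :+ (a :* ι₀ :+ b :* ι₀)))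
      := X :+ (a :* (X :+ (a :* ι₀ :+ b :* ι₀)) :+ b :* (X :+ (a :* ι₁ :+ b :* ι₀))))
      refl X a b (ι R 0) (ι R 1)

  module _ (l k : ℕ) (a : Fin (suc (suc k)) → Carrier) (c₀ : Carrier) where
    private
      F = linF R (suc (suc k)) a c₀

    linF-plane : ∀ u v → F (plane l k u v) ≈ affine (F (plane l k 0 0)) (a fzero) (a (fsuc fzero)) u v
    linF-plane u v = begin
      a₀ * ι R (u ℕ.+ l) + (a₁ * ι R (v ℕ.+ l) + S) + c₀
        ≈⟨ +-congʳ (+-cong (*-congˡ (ι-+ u l)) (+-congʳ (*-congˡ (ι-+ v l)))) ⟩
      a₀ * (ι R u + ι R l) + (a₁ * (ι R v + ι R l) + S) + c₀
        ≈⟨ solve 7 (λ a₀ a₁ U V L S c₀ →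
              a₀ :* (U :+ L) :+ (a₁ :* (V :+ L) :+ S) :+ c₀
           := (a₀ :* L :+ (a₁ :* L :+ S) :+ c₀) :+ (a₀ :* U :+ a₁ :* V))
           refl a₀ a₁ (ι R u) (ι R v) (ι R l) S c₀ ⟩
      (a₀ * ι R l + (a₁ * ι R l + S) + c₀) + (a₀ * ι R u + a₁ * ι R v) ∎
      where
      a₀ = a fzero
      a₁ = a (fsuc fzero)
      S = sumFin R k (λ i → a (fsuc (fsuc i)) * ι R l)

lemma1 : {c ℓ : Level} (R : RealNumbers c ℓ) (l m : ℕ) → 2 ≤ m →
         (a : Fin m → RealNumbers.Carrier R) (c₀ : RealNumbers.Carrier R) →
         ¬ StoringLinear R l m a c₀
lemma1 R l (suc (suc k)) (s≤s (s≤s z≤n)) a c₀ (integral , injective) =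
  0≢1+n (plane-injectiveˡ (injective-on-plane 0 0 1 0 G₀₀≈G₁₀))
  where
  open RealNumbers R

  G : ℕ → ℕ → Carrier
  G u v = linF R (suc (suc k)) a c₀ (plane l k u v)

  value : ∀ u v → ∃ λ n → G u v ≈ ι R n
  value u v = integral (plane l k u v) (plane-InS R l k u v)

  injective-on-plane : ∀ u v u′ v′ → G u v ≈ G u′ v′ → ∀ i → plane l k u v i ≡ plane l k u′ v′ i
  injective-on-plane u v u′ v′ = injective _ _ (plane-InS R l k u v) (plane-InS R l k u′ v′)

  natural-at : ∀ u v → ι R (proj₁ (value u v)) ≈ affine R (G 0 0) (a fzero) (a (fsuc fzero)) u v
  natural-at u v = trans (sym (proj₂ (value u v))) (linF-plane R l k a c₀ u v)

  p q r : ℕ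
  p = proj₁ (value 0 0)
  q = proj₁ (value 1 0)
  r = proj₁ (value 0 1)

  collision : G r p ≈ G p q
  collision = trans (linF-plane R l k a c₀ r p)
    (trans (affine-collision R {p = p} {q} {r} (natural-at 0 0) (natural-at 1 0) (natural-at 0 1))
           (sym (linF-plane R l k a c₀ p q)))

  p≡q : p ≡ q
  p≡q = plane-injectiveʳ (injective-on-plane r p p q collision)

  G₀₀≈G₁₀ : G 0 0 ≈ G 1 0
  G₀₀≈G₁₀ = trans (proj₂ (value 0 0)) (trans (reflexive (cong (ι R) p≡q)) (sym (proj₂ (value 1 0))))
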